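{- Let $R$ be a commutative ring with unity having ideals $I,J,K$ such that $(I+K)\cap(J+K)\neq(I\cap J)+K$. Then there exists an edge-labeling $\alpha$ of the diamond graph over $R$ such that $(\text{diamond},\alpha)$ does not satisfy the Universal Difference Property.
   Context: The diamond graph is the graph on 4 vertices with 5 edges (the complete graph $K_4$ with one edge removed). An edge-labeling assigns to each edge an ideal of $R$. A spline on $(G,\alpha)$ is a function $\rho:V(G)\to R$ with $\rho(u)-\rho(v)\in\alpha(uv)$ for every edge $uv$. For a path $P$ (no repeated vertices), $\alpha(P)$ is the sum of the labels of its edges. $(G,\alpha)$ satisfies the Universal Difference Property if for every pair of vertices $u,w$ and every $x\in\bigcap_P\alpha(P)$ (over all paths $P$ from $u$ to $w$) there is a spline $\rho$ with $\rho(u)-\rho(w)=x$. -}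

module Defs where

open import Level using (Level; _⊔_; Lift) renaming (suc to lsuc)
open import Algebra.Bundles using (CommutativeRing)
open import Data.Fin using (Fin; zero; suc)
open import Data.Product using (Σ; ∃; _×_; _,_)
open import Data.Sum using (_⊎_)
open import Data.List using (List; []; _∷_)
open import Data.List.Relation.Unary.Unique.Propositional using (Unique)
open import Relation.Binary.PropositionalEquality using (_≡_)
open import Relation.Nullary using (¬_)

module _ {c ℓ : Level} (R : CommutativeRing c ℓ) where
  open CommutativeRing R

  record Ideal (p : Level) : Set (c ⊔ ℓ ⊔ lsuc p) where
    field
      member  : Carrier → Set p
      ∈-resp  : ∀ {x y} → x ≈ y → member x → member y
      0∈      : member 0#
      +-∈     : ∀ {x y} → member x → member y → member (x + y)
      neg-∈   : ∀ {x} → member x → member (- x)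
      *-∈     : ∀ r {x} → member x → member (r * x)

  open Ideal public

  Pred : (p : Level) → Set (c ⊔ lsuc p)
  Pred p = Carrier → Set p

  mem : ∀ {p} → Ideal p → Pred p
  mem I = member I

  Sum : ∀ {p q} → Pred p → Pred q → Pred (c ⊔ ℓ ⊔ p ⊔ q)
  Sum A B x = Σ Carrier λ a → Σ Carrier λ b → A a × B b × (x ≈ a + b)

  Inter : ∀ {p q} → Pred p → Pred q → Pred (p ⊔ q)
  Inter A B x = A x × B x

-- The diamond graph: K₄ minus the edge {0,3}.
-- Vertices Fin 4; the five edges are
--   e0 = {0,1}, e1 = {0,2}, e2 = {1,2}, e3 = {1,3}, e4 = {2,3}.

Vertex : Set
Vertex = Fin 4

Edge : Set
Edge = Fin 5

endpoints : Edge → Vertex × Vertex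
endpoints zero                         = (zero , suc zero)
endpoints (suc zero)                   = (zero , suc (suc zero))
endpoints (suc (suc zero))             = (suc zero , suc (suc zero))
endpoints (suc (suc (suc zero)))       = (suc zero , suc (suc (suc zero)))
endpoints (suc (suc (suc (suc zero)))) = (suc (suc zero) , suc (suc (suc zero)))

Joins : Edge → Vertex → Vertex → Set
Joins e u v = (endpoints e ≡ (u , v)) ⊎ (endpoints e ≡ (v , u))

data Walk : Vertex → Vertex → Set where
  stop : ∀ {u} → Walk u u
  step : ∀ {u v w} (e : Edge) → Joins e u v → Walk v w → Walk u w

walkVertices : ∀ {u w} → Walk u w → List Vertex
walkVertices {u} stop          = u ∷ []
walkVertices {u} (step _ _ P)  = u ∷ walkVertices P

walkEdges : ∀ {u w} → Walk u w → List Edge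
walkEdges stop         = []
walkEdges (step e _ P) = e ∷ walkEdges P

IsPath : ∀ {u w} → Walk u w → Set
IsPath P = Unique (walkVertices P)

module _ {c ℓ : Level} (R : CommutativeRing c ℓ) where
  open CommutativeRing R

  Labeling : (p : Level) → Set (c ⊔ ℓ ⊔ lsuc p)
  Labeling p = Edge → Ideal R p

  InSumLabels : ∀ {p} → Labeling p → List Edge → Carrier → Set (c ⊔ ℓ ⊔ p)
  InSumLabels {p} α []       x = Lift (c ⊔ p) (x ≈ 0#)
  InSumLabels α (e ∷ es) x = Σ Carrier λ a → Σ Carrier λ b →
    (member (α e) a) × InSumLabels α es b × (x ≈ a + b)

  InPathLabel : ∀ {p} → Labeling p → ∀ {u w} → Walk u w → Carrier → Set (c ⊔ ℓ ⊔ p)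
  InPathLabel α P x = InSumLabels α (walkEdges P) x

  IsSpline : ∀ {p} → Labeling p → (Vertex → Carrier) → Set p
  IsSpline α ρ = ∀ (e : Edge) → let (u , v) = endpoints e in
    member (α e) (ρ u - ρ v)

  UniversalDifferenceProperty : ∀ {p} → Labeling p → Set (c ⊔ ℓ ⊔ p)
  UniversalDifferenceProperty α =
    ∀ (u w : Vertex) (x : Carrier) →
    (∀ (P : Walk u w) → IsPath P → InPathLabel α P x) →
    Σ (Vertex → Carrier) λ ρ → IsSpline α ρ × (ρ u - ρ w ≈ x)

-- Label the edges {0,1}, {0,2}, {1,2}, {1,3}, {2,3} of the diamond by I, J, J, K, K.
-- Every walk from 0 to 3 starts along the I-edge or a J-edge and ends along a
-- K-edge, so (I + K) ∩ (J + K) lies in the label of every path from 0 to 3.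
-- For a spline ρ, however, ρ₀ − ρ₁ ∈ I ∩ J (going through vertex 2 for J) and
-- ρ₁ − ρ₃ ∈ K, so ρ₀ − ρ₃ ∈ (I ∩ J) + K. The universal difference property would
-- therefore give (I + K) ∩ (J + K) ⊆ (I ∩ J) + K, and the reverse inclusion
-- holds for any three ideals.
module Submission where

open import Defs
open import Level using (Level; _⊔_; Lift; lift; lower)
open import Algebra.Bundles using (CommutativeRing)
open import Data.Fin using (zero; suc)
open import Data.Product using (Σ; _,_)
open import Data.Sum using (inj₁; inj₂)
open import Function.Bundles using (_⇔_; mk⇔)
open import Relation.Nullary using (¬_)
open import Relation.Binary.PropositionalEquality using () renaming (refl to ≡-refl)
import Algebra.Properties.AbelianGroup as AbelianGroupProperties
import Relation.Binary.Reasoning.Setoid as SetoidReasoning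

pattern v₀ = zero
pattern v₁ = suc zero
pattern v₂ = suc (suc zero)
pattern v₃ = suc (suc (suc zero))

pattern e₀ = zero
pattern e₁ = suc zero
pattern e₂ = suc (suc zero)
pattern e₃ = suc (suc (suc zero))
pattern e₄ = suc (suc (suc (suc zero)))

module _ {c ℓ : Level} (R : CommutativeRing c ℓ) where
  open CommutativeRing R hiding (zero)
  open AbelianGroupProperties +-abelianGroup using (⁻¹-anti-homo‿-)
  open SetoidReasoning setoid

  x-y+y-z≈x-z : ∀ x y z → (x - y) + (y - z) ≈ x - z
  x-y+y-z≈x-z x y z = begin
    (x - y) + (y - z)    ≈⟨ +-assoc x (- y) (y - z) ⟩
    x + (- y + (y - z))  ≈⟨ +-congˡ (sym (+-assoc (- y) y (- z))) ⟩
    x + ((- y + y) - z)  ≈⟨ +-congˡ (+-congʳ (-‿inverseˡ y)) ⟩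
    x + (0# - z)         ≈⟨ +-congˡ (+-identityˡ (- z)) ⟩
    x - z                ∎

  module _ {p : Level} (I : Ideal R p) where

    ∈-diff-sym : ∀ {x y} → member I (x - y) → member I (y - x)
    ∈-diff-sym {x} {y} x-y∈I = ∈-resp I (⁻¹-anti-homo‿- x y) (neg-∈ I x-y∈I)

    ∈-diff-trans : ∀ {x y z} → member I (x - y) → member I (y - z) → member I (x - z)
    ∈-diff-trans {x} {y} {z} x-y∈I y-z∈I =
      ∈-resp I (x-y+y-z≈x-z x y z) (+-∈ I x-y∈I y-z∈I)

  liftIdeal : ∀ {p} q → Ideal R p → Ideal R (p ⊔ q)
  liftIdeal q I = record
    { member = λ x → Lift q (member I x)
    ; ∈-resp = λ x≈y x∈I → lift (∈-resp I x≈y (lower x∈I))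
    ; 0∈     = lift (0∈ I)
    ; +-∈    = λ x∈I y∈I → lift (+-∈ I (lower x∈I) (lower y∈I))
    ; neg-∈  = λ x∈I → lift (neg-∈ I (lower x∈I))
    ; *-∈    = λ r x∈I → lift (*-∈ I r (lower x∈I))
    }

  Sum-Inter⊆Inter-Sum : ∀ {p q r} {A : Pred R p} {B : Pred R q} {C : Pred R r} {x} →
    Sum R (Inter R A B) C x → Inter R (Sum R A C) (Sum R B C) x
  Sum-Inter⊆Inter-Sum (a , b , (a∈A , a∈B) , b∈C , x≈a+b) =
    (a , b , a∈A , b∈C , x≈a+b) , (a , b , a∈B , b∈C , x≈a+b)

  -- Every edge of the walk but the last contributes 0 to the sum.
  ∈-label-of-walk-into : ∀ {p} (α : Labeling R p) {w x} →
    (∀ e v → Joins e v w → member (α e) x) →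
    ∀ {u v} e (j : Joins e u v) (P : Walk v w) → InPathLabel R α (step e j P) x
  ∈-label-of-walk-into α x∈ e j stop =
    _ , 0# , x∈ e _ j , lift refl , sym (+-identityʳ _)
  ∈-label-of-walk-into α x∈ e j (step e′ j′ P) =
    0# , _ , 0∈ (α e) , ∈-label-of-walk-into α x∈ e′ j′ P , sym (+-identityˡ _)

module Diamond {c ℓ p : Level} (R : CommutativeRing c ℓ) (I J K : Ideal R p) where
  open CommutativeRing R hiding (zero)

  α : Labeling R (c ⊔ ℓ ⊔ p)
  α e₀ = liftIdeal R (c ⊔ ℓ) I
  α e₁ = liftIdeal R (c ⊔ ℓ) J
  α e₂ = liftIdeal R (c ⊔ ℓ) J
  α e₃ = liftIdeal R (c ⊔ ℓ) K
  α e₄ = liftIdeal R (c ⊔ ℓ) K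

  ∈-labels-into-v₃ : ∀ {x} → member K x → ∀ e v → Joins e v v₃ → member (α e) x
  ∈-labels-into-v₃ x∈K e₃ _ _        = lift x∈K
  ∈-labels-into-v₃ x∈K e₄ _ _        = lift x∈K
  ∈-labels-into-v₃ x∈K e₀ _ (inj₁ ())
  ∈-labels-into-v₃ x∈K e₀ _ (inj₂ ())
  ∈-labels-into-v₃ x∈K e₁ _ (inj₁ ())
  ∈-labels-into-v₃ x∈K e₁ _ (inj₂ ())
  ∈-labels-into-v₃ x∈K e₂ _ (inj₁ ())
  ∈-labels-into-v₃ x∈K e₂ _ (inj₂ ())

  ∈-label-of-walk-v₀v₃ : ∀ {x} →
    Inter R (Sum R (mem R I) (mem R K)) (Sum R (mem R J) (mem R K)) x →
    (P : Walk v₀ v₃) → InPathLabel R α P x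
  ∈-label-of-walk-v₀v₃ ((a , b , a∈I , b∈K , x≈a+b) , _) (step e₀ (inj₁ ≡-refl) (step e j P)) =
    a , b , lift a∈I , ∈-label-of-walk-into R α (∈-labels-into-v₃ b∈K) e j P , x≈a+b
  ∈-label-of-walk-v₀v₃ (_ , (a , b , a∈J , b∈K , x≈a+b)) (step e₁ (inj₁ ≡-refl) (step e j P)) =
    a , b , lift a∈J , ∈-label-of-walk-into R α (∈-labels-into-v₃ b∈K) e j P , x≈a+b
  ∈-label-of-walk-v₀v₃ _ (step e₀ (inj₂ ()) _)
  ∈-label-of-walk-v₀v₃ _ (step e₁ (inj₂ ()) _)
  ∈-label-of-walk-v₀v₃ _ (step e₂ (inj₁ ()) _)
  ∈-label-of-walk-v₀v₃ _ (step e₂ (inj₂ ()) _)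
  ∈-label-of-walk-v₀v₃ _ (step e₃ (inj₁ ()) _)
  ∈-label-of-walk-v₀v₃ _ (step e₃ (inj₂ ()) _)
  ∈-label-of-walk-v₀v₃ _ (step e₄ (inj₁ ()) _)
  ∈-label-of-walk-v₀v₃ _ (step e₄ (inj₂ ()) _)

  spline-diff-v₀v₃ : ∀ {ρ} → IsSpline R α ρ →
    Sum R (Inter R (mem R I) (mem R J)) (mem R K) (ρ v₀ - ρ v₃)
  spline-diff-v₀v₃ {ρ} s =
    ρ v₀ - ρ v₁ , ρ v₁ - ρ v₃ ,
    (lower (s e₀) , ∈-diff-trans R J (lower (s e₁)) (∈-diff-sym R J (lower (s e₂)))) ,
    lower (s e₃) , sym (x-y+y-z≈x-z R (ρ v₀) (ρ v₁) (ρ v₃))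

  udp⇒Inter-Sum⊆Sum-Inter : UniversalDifferenceProperty R α → ∀ {x} →
    Inter R (Sum R (mem R I) (mem R K)) (Sum R (mem R J) (mem R K)) x →
    Sum R (Inter R (mem R I) (mem R J)) (mem R K) x
  udp⇒Inter-Sum⊆Sum-Inter udp {x} x∈ =
    let ρ , s , ρ₀-ρ₃≈x = udp v₀ v₃ x (λ P _ → ∈-label-of-walk-v₀v₃ x∈ P)
        a , b , a∈I∩J , b∈K , ρ₀-ρ₃≈a+b = spline-diff-v₀v₃ {ρ} s
    in a , b , a∈I∩J , b∈K , trans (sym ρ₀-ρ₃≈x) ρ₀-ρ₃≈a+b

theorem3p9 : ∀ {c ℓ p : Level} (R : CommutativeRing c ℓ) (I J K : Ideal R p) →
    ¬ (∀ x → Inter R (Sum R (mem R I) (mem R K)) (Sum R (mem R J) (mem R K)) x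
              ⇔ Sum R (Inter R (mem R I) (mem R J)) (mem R K) x) →
    Σ (Labeling R (c ⊔ ℓ ⊔ p)) λ α → ¬ UniversalDifferenceProperty R α
theorem3p9 R I J K not-distributive =
  α , λ udp → not-distributive λ _ →
    mk⇔ (udp⇒Inter-Sum⊆Sum-Inter udp) (Sum-Inter⊆Inter-Sum R)
  where open Diamond R I J K
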